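{- There is a constant $c>0$ such that every cycle $G$ with $n$ vertices satisfies $\widetilde{\mathsf{VC}}(G)\ge c\,n^2$.
   Context: Unweighted deterministic walk: each vertex $u$ has a rotor sequence of length $\tilde d(u)$ of neighbours of $u$, each occurring exactly $\tilde d(u)/\deg(u)$ times, and an initial rotor position; the walk moves from the current vertex to the vertex its rotor points at and then advances that rotor cyclically. $\widetilde{\mathsf{VC}}(G)$ is the maximum over start vertices and all rotor sequences/initial positions (lengths fixed) of the least $t$ by which all vertices have been visited. -}

module Defs where

open import Data.Nat using (ℕ; zero; suc; _+_; _*_; _≤_; _<_; _<?_)
open import Data.Nat.DivMod using (_%_)
open import Data.Fin using (Fin; toℕ; fromℕ<; _≟_)
import Data.Fin as F
open import Data.Bool using (Bool; true; false; if_then_else_)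
open import Data.Empty using (⊥)
open import Data.Sum using (_⊎_)
open import Data.Product using (Σ; ∃; _×_; _,_; proj₁; proj₂)
open import Relation.Nullary using (yes; no; ¬_)
open import Relation.Nullary.Decidable using (⌊_⌋)
open import Relation.Binary.PropositionalEquality using (_≡_)

CycleAdj : (n : ℕ) → Fin n → Fin n → Set
CycleAdj zero    u v = ⊥
CycleAdj (suc n) u v = ((toℕ u + 1) % suc n ≡ toℕ v) ⊎ ((toℕ v + 1) % suc n ≡ toℕ u)

countFin : (L : ℕ) → (Fin L → Bool) → ℕ
countFin zero    P = 0
countFin (suc L) P = (if P F.zero then 1 else 0) + countFin L (λ k → P (F.suc k))

occ : ∀ {n} (L : ℕ) → (Fin L → Fin n) → Fin n → ℕ
occ L s v = countFin L (λ k → ⌊ s k ≟ v ⌋)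

-- A rotor sequence at u of length m·deg(u) = m·2 in the cycle: every neighbour
-- of u occurs exactly m times, non-neighbours never occur.
ValidRotorSeq : (n : ℕ) (u : Fin n) (m : ℕ) → (Fin (m * 2) → Fin n) → Set
ValidRotorSeq n u m s =
  ∀ v → (CycleAdj n u v → occ (m * 2) s v ≡ m) × (¬ CycleAdj n u v → occ (m * 2) s v ≡ 0)

nextFin : ∀ {L} → Fin L → Fin L
nextFin {suc L} i with suc (toℕ i) <? suc L
... | yes p = fromℕ< p
... | no _  = F.zero

State : (n : ℕ) (L : Fin n → ℕ) → Set
State n L = Fin n × ((u : Fin n) → Fin (L u))

advance : ∀ {n} {L : Fin n → ℕ} → ((u : Fin n) → Fin (L u)) → Fin n → (u : Fin n) → Fin (L u)
advance ρ x u with u ≟ x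
... | yes _ = nextFin (ρ u)
... | no _  = ρ u

step : ∀ {n} {L : Fin n → ℕ} → ((u : Fin n) → Fin (L u) → Fin n) → State n L → State n L
step seq (x , ρ) = seq x (ρ x) , advance ρ x

walk : ∀ {n} {L : Fin n → ℕ} → ((u : Fin n) → Fin (L u) → Fin n) → State n L → ℕ → State n L
walk seq s0 zero    = s0
walk seq s0 (suc t) = step seq (walk seq s0 t)

CoveredBy : ∀ {n} {L : Fin n → ℕ} → ((u : Fin n) → Fin (L u) → Fin n) → State n L → ℕ → Set
CoveredBy {n} seq s0 t = ∀ (v : Fin n) → ∃ λ s → s ≤ t × proj₁ (walk seq s0 s) ≡ v

module Submission where

-- All rotor sequences alternate right, left, right, …, so
-- a rotor is a direction that flips whenever the walker leaves its vertex;
-- rotors at positions ≤ h = ⌊N/2⌋ start facing right, the others left, and the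
-- walk starts at h.  It then sweeps back and forth over a growing interval
-- [l, r] ∋ h, the k-th pass having length k, so completing a pass of width w
-- takes tri w = 1 + … + w steps in total.
--
-- The invariant `Sweep`, built on the rotor `Pattern`, survives
-- each of the four moves (advance/extend, right/left), and running off the arc
-- {0, …, N-1} takes N²/8 steps; so every time t < N²/8 is inside a sweep, where
-- covering all vertices would already need tri (N-1) ≥ N²/8 steps.

open import Defs
open import Data.Nat using (ℕ; zero; suc; _+_; _*_; _≤_; _<_; z≤n; s≤s; z<s; _≤?_; _<?_; ⌊_/2⌋; ⌈_/2⌉)
open import Data.Nat.Properties hiding (_≟_)
open import Data.Nat.DivMod using (_%_; m%n<n; m<n⇒m%n≡m; n%n≡0)
open import Data.Fin using (Fin; toℕ; fromℕ<; fromℕ; inject₁; _≟_)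
import Data.Fin as F
open import Data.Fin.Properties using (toℕ-fromℕ<; toℕ-injective; toℕ-inject₁; toℕ-fromℕ; toℕ<n)
open import Data.Sum using (_⊎_; inj₁; inj₂)
open import Relation.Nullary using (Dec; yes; no; ¬_)
open import Relation.Nullary.Decidable using (⌊_⌋; isYes≗does; dec-true; dec-false)
open import Data.Nat.Tactic.RingSolver using (solve-∀)
open import Data.Product using (∃; _×_; _,_; proj₁; proj₂)
open import Data.Bool using (Bool; true; false; not; if_then_else_)
open import Data.Empty using (⊥-elim)
open import Function using (_∘_)
open import Relation.Binary.PropositionalEquality

impossible : ∀ {a b} {A : Set} → a ≤ b → b < a → A
impossible a≤b b<a = ⊥-elim (<⇒≱ b<a a≤b)

tri : ℕ → ℕ
tri zero    = 0
tri (suc w) = tri w + suc w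

double-tri : ∀ k → 2 * tri k ≡ k * suc k
double-tri zero    = refl
double-tri (suc k) = begin
  2 * (tri k + suc k)       ≡⟨ *-distribˡ-+ 2 (tri k) (suc k) ⟩
  2 * tri k + 2 * suc k     ≡⟨ cong (_+ 2 * suc k) (double-tri k) ⟩
  k * suc k + 2 * suc k     ≡⟨ rearrange k ⟩
  suc k * suc (suc k)       ∎
  where
  open ≡-Reasoning
  rearrange : ∀ k → k * suc k + 2 * suc k ≡ suc k * suc (suc k)
  rearrange = solve-∀

-- How the clock of a sweep advances: one more step of the current pass, or
-- the last step of a pass of length w, which starts the pass of length w + 1.
tick : ∀ w {s p} → s ≡ tri w + p → suc s ≡ tri w + suc p
tick w {p = p} s≡ = trans (cong suc s≡) (sym (+-suc (tri w) p))

turn : ∀ w {s} → s ≡ tri w + w → suc s ≡ tri (suc w)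
turn w = tick w

quadratic : ∀ N k → N ≤ 2 * k → N * N ≤ 8 * tri k
quadratic N k N≤2k = begin
  N * N                 ≤⟨ *-mono-≤ N≤2k N≤2k ⟩
  (2 * k) * (2 * k)     ≡⟨ square k ⟩
  4 * (k * k)           ≤⟨ *-monoʳ-≤ 4 (*-monoʳ-≤ k (n≤1+n k)) ⟩
  4 * (k * suc k)       ≡⟨ cong (4 *_) (sym (double-tri k)) ⟩
  4 * (2 * tri k)       ≡⟨ sym (*-assoc 4 2 (tri k)) ⟩
  8 * tri k             ∎
  where
  open ≤-Reasoning
  square : ∀ k → (2 * k) * (2 * k) ≡ 4 * (k * k)
  square = solve-∀

half-lower : ∀ N → ⌊ N /2⌋ + ⌊ N /2⌋ ≤ N
half-lower N = begin
  ⌊ N /2⌋ + ⌊ N /2⌋ ≤⟨ +-monoʳ-≤ ⌊ N /2⌋ (⌊n/2⌋≤⌈n/2⌉ N) ⟩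
  ⌊ N /2⌋ + ⌈ N /2⌉ ≡⟨ ⌊n/2⌋+⌈n/2⌉≡n N ⟩
  N                 ∎
  where open ≤-Reasoning

half-upper : ∀ N → N ≤ suc (⌊ N /2⌋ + ⌊ N /2⌋)
half-upper zero          = z≤n
half-upper (suc zero)    = s≤s z≤n
half-upper (suc (suc N)) rewrite +-suc ⌊ N /2⌋ ⌊ N /2⌋ = s≤s (s≤s (half-upper N))

-- Arithmetic behind the two ways a sweep can leave the arc {0, …, N-1}: if it
-- runs off the right end, the swept interval [l, l+w] ends at N-1 and starts
-- left of the midpoint; if it runs off the left end, it starts at 0 and ends
-- right of the midpoint.
wrap-right-width : ∀ N l w h → N ≡ suc (l + w) → l ≤ h → h + h ≤ N → N ≤ 2 * suc w
wrap-right-width N l w h N≡ l≤h h+h≤N = +-cancelˡ-≤ N N (2 * suc w) (begin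
  N + N                        ≡⟨ cong₂ _+_ N≡ N≡ ⟩
  suc (l + w) + suc (l + w)    ≤⟨ +-mono-≤ (s≤s (+-monoˡ-≤ w l≤h)) (s≤s (+-monoˡ-≤ w l≤h)) ⟩
  suc (h + w) + suc (h + w)    ≡⟨ regroup h w ⟩
  (h + h) + 2 * suc w          ≤⟨ +-monoˡ-≤ (2 * suc w) h+h≤N ⟩
  N + 2 * suc w                ∎)
  where
  open ≤-Reasoning
  regroup : ∀ h w → suc (h + w) + suc (h + w) ≡ (h + h) + 2 * suc w
  regroup = solve-∀

wrap-left-width : ∀ N w h → h ≤ w → N ≤ suc (h + h) → N ≤ 2 * suc w
wrap-left-width N w h h≤w N≤ = begin
  N                  ≤⟨ N≤ ⟩
  suc (h + h)        ≤⟨ s≤s (+-mono-≤ h≤w h≤w) ⟩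
  suc (w + w)        ≤⟨ n≤1+n _ ⟩
  suc (suc (w + w))  ≡⟨ twice w ⟩
  2 * suc w          ∎
  where
  open ≤-Reasoning
  twice : ∀ w → suc (suc (w + w)) ≡ 2 * suc w
  twice = solve-∀

-- Parity; a rotor position of even parity will point right, odd parity left.
isEven : ℕ → Bool
isEven zero          = true
isEven (suc zero)    = false
isEven (suc (suc k)) = isEven k

isEven-suc : ∀ k → isEven (suc k) ≡ not (isEven k)
isEven-suc zero          = refl
isEven-suc (suc zero)    = refl
isEven-suc (suc (suc k)) = isEven-suc k

isEven-double : ∀ m → isEven (m * 2) ≡ true
isEven-double zero    = refl
isEven-double (suc m) = isEven-double m

-- On a cyclic index set of even length, advancing a rotor flips its parity
-- (the wrap-around from L-1 to 0 included, because L-1 is odd).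
nextFin-flips-parity : ∀ L (i : Fin L) → isEven L ≡ true →
                       isEven (toℕ (nextFin i)) ≡ not (isEven (toℕ i))
nextFin-flips-parity (suc L) i L-even with suc (toℕ i) <? suc L
... | yes i+1<L = trans (cong isEven (toℕ-fromℕ< i+1<L)) (isEven-suc (toℕ i))
... | no  i+1≮L = begin
  true                    ≡⟨ sym L-even ⟩
  isEven (suc L)          ≡⟨ isEven-suc L ⟩
  not (isEven L)          ≡⟨ cong (not ∘ isEven) (sym i≡L) ⟩
  not (isEven (toℕ i))    ∎
  where
  open ≡-Reasoning
  i≡L : toℕ i ≡ L
  i≡L = ≤-antisym (≤-pred (toℕ<n i)) (≤-pred (≮⇒≥ i+1≮L))

countFin-cong : ∀ L (P Q : Fin L → Bool) → (∀ k → P k ≡ Q k) → countFin L P ≡ countFin L Q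
countFin-cong zero    P Q P≗Q = refl
countFin-cong (suc L) P Q P≗Q =
  cong₂ _+_ (cong (λ b → if b then 1 else 0) (P≗Q F.zero))
            (countFin-cong L (P ∘ F.suc) (Q ∘ F.suc) (P≗Q ∘ F.suc))

countFin-never : ∀ L → countFin L (λ _ → false) ≡ 0
countFin-never zero    = refl
countFin-never (suc L) = countFin-never L

countFin-even : ∀ m → countFin (m * 2) (isEven ∘ toℕ) ≡ m
countFin-even zero    = refl
countFin-even (suc m) = cong suc (countFin-even m)

countFin-odd : ∀ m → countFin (m * 2) (not ∘ isEven ∘ toℕ) ≡ m
countFin-odd zero    = refl
countFin-odd (suc m) = cong suc (countFin-odd m)

≟-yes : ∀ {L} {a b : Fin L} → a ≡ b → ⌊ a ≟ b ⌋ ≡ true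
≟-yes {a = a} {b} a≡b = trans (isYes≗does (a ≟ b)) (dec-true (a ≟ b) a≡b)

≟-no : ∀ {L} {a b : Fin L} → a ≢ b → ⌊ a ≟ b ⌋ ≡ false
≟-no {a = a} {b} a≢b = trans (isYes≗does (a ≟ b)) (dec-false (a ≟ b) a≢b)

advance-here : ∀ {n} {L : Fin n → ℕ} (ρ : (u : Fin n) → Fin (L u)) x → advance ρ x x ≡ nextFin (ρ x)
advance-here ρ x with x ≟ x
... | yes _   = refl
... | no  x≢x = ⊥-elim (x≢x refl)

advance-elsewhere : ∀ {n} {L : Fin n → ℕ} (ρ : (u : Fin n) → Fin (L u)) x v → v ≢ x → advance ρ x v ≡ ρ v
advance-elsewhere ρ x v v≢x with v ≟ x
... | yes v≡x = ⊥-elim (v≢x v≡x)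
... | no  _   = refl

module Cycle (n' : ℕ) (2≤n' : 2 ≤ n') where

  N : ℕ
  N = suc n'

  right : Fin N → Fin N
  right u = fromℕ< (m%n<n (toℕ u + 1) N)

  left : Fin N → Fin N
  left F.zero    = fromℕ n'
  left (F.suc y) = inject₁ y

  toℕ-right : ∀ u → toℕ (right u) ≡ (toℕ u + 1) % N
  toℕ-right u = toℕ-fromℕ< (m%n<n (toℕ u + 1) N)

  right-step : ∀ u → suc (toℕ u) < N → toℕ (right u) ≡ suc (toℕ u)
  right-step u u+1<N = begin
    toℕ (right u)        ≡⟨ toℕ-right u ⟩
    (toℕ u + 1) % N      ≡⟨ cong (_% N) (+-comm (toℕ u) 1) ⟩
    suc (toℕ u) % N      ≡⟨ m<n⇒m%n≡m u+1<N ⟩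
    suc (toℕ u)          ∎
    where open ≡-Reasoning

  right-wrap : ∀ u → toℕ u ≡ n' → toℕ (right u) ≡ 0
  right-wrap u u≡n' = begin
    toℕ (right u)        ≡⟨ toℕ-right u ⟩
    (toℕ u + 1) % N      ≡⟨ cong (_% N) (trans (+-comm (toℕ u) 1) (cong suc u≡n')) ⟩
    N % N                ≡⟨ n%n≡0 N ⟩
    0                    ∎
    where open ≡-Reasoning

  last-or-not : ∀ u → suc (toℕ u) < N ⊎ toℕ u ≡ n'
  last-or-not u with m≤n⇒m<n∨m≡n (≤-pred (toℕ<n u))
  ... | inj₁ u<n' = inj₁ (s≤s u<n')
  ... | inj₂ u≡n' = inj₂ u≡n'

  left-step : ∀ u k → toℕ u ≡ suc k → toℕ (left u) ≡ k
  left-step (F.suc y) k y+1≡k+1 = trans (toℕ-inject₁ y) (suc-injective y+1≡k+1)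

  left-right : ∀ u → left (right u) ≡ u
  left-right u with last-or-not u
  ... | inj₁ u+1<N = toℕ-injective (left-step (right u) (toℕ u) (right-step u u+1<N))
  ... | inj₂ u≡n' rewrite toℕ-injective {i = right u} {j = F.zero} (right-wrap u u≡n') =
    toℕ-injective (trans (toℕ-fromℕ n') (sym u≡n'))

  right-left : ∀ u → right (left u) ≡ u
  right-left F.zero    = toℕ-injective (right-wrap (fromℕ n') (toℕ-fromℕ n'))
  right-left (F.suc y) = toℕ-injective (begin
    toℕ (right (inject₁ y))  ≡⟨ right-step (inject₁ y) y+1<N ⟩
    suc (toℕ (inject₁ y))    ≡⟨ cong suc (toℕ-inject₁ y) ⟩
    suc (toℕ y)              ∎)
    where
    open ≡-Reasoning
    y+1<N : suc (toℕ (inject₁ y)) < N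
    y+1<N = subst (λ k → suc k < N) (sym (toℕ-inject₁ y)) (s≤s (toℕ<n y))

  neighbours : ∀ u v → CycleAdj N u v → v ≡ right u ⊎ v ≡ left u
  neighbours u v (inj₁ u+1≡v) = inj₁ (toℕ-injective (trans (sym u+1≡v) (sym (toℕ-right u))))
  neighbours u v (inj₂ v+1≡u) = inj₂ (begin
    v                ≡⟨ sym (left-right v) ⟩
    left (right v)   ≡⟨ cong left (toℕ-injective (trans (toℕ-right v) v+1≡u)) ⟩
    left u           ∎)
    where open ≡-Reasoning

  right-adjacent : ∀ u → CycleAdj N u (right u)
  right-adjacent u = inj₁ (sym (toℕ-right u))

  left-adjacent : ∀ u → CycleAdj N u (left u)
  left-adjacent u = inj₂ (trans (sym (toℕ-right (left u))) (cong toℕ (right-left u)))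

  right≢left : ∀ u → right u ≢ left u
  right≢left F.zero right≡left = n'≢1 (begin
    n'                      ≡⟨ sym (toℕ-fromℕ n') ⟩
    toℕ (left F.zero)       ≡⟨ cong toℕ (sym right≡left) ⟩
    toℕ (right F.zero)      ≡⟨ right-step F.zero (s≤s (≤-trans (s≤s z≤n) 2≤n')) ⟩
    1                       ∎)
    where
    open ≡-Reasoning
    n'≢1 : n' ≢ 1
    n'≢1 n'≡1 = <⇒≱ 2≤n' (≤-reflexive n'≡1)
  right≢left (F.suc y) right≡left with last-or-not (F.suc y)
  ... | inj₁ y+2<N = <⇒≢ (m<n⇒m<1+n (n<1+n (toℕ y))) (sym (begin
    suc (suc (toℕ y))          ≡⟨ sym (right-step (F.suc y) y+2<N) ⟩
    toℕ (right (F.suc y))      ≡⟨ cong toℕ right≡left ⟩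
    toℕ (inject₁ y)            ≡⟨ toℕ-inject₁ y ⟩
    toℕ y                      ∎))
    where open ≡-Reasoning
  ... | inj₂ y+1≡n' = <⇒≱ 2≤n' (≤-reflexive (trans (sym y+1≡n') (cong suc y≡0)))
    where
    y≡0 : toℕ y ≡ 0
    y≡0 = trans (sym (toℕ-inject₁ y)) (trans (cong toℕ (sym right≡left)) (right-wrap (F.suc y) y+1≡n'))

  alternating : ∀ {L} → Fin N → Fin L → Fin N
  alternating u k = if isEven (toℕ k) then right u else left u

  alternating-hits : ∀ {L} u v (k : Fin L) →
    ⌊ alternating u k ≟ v ⌋ ≡ (if isEven (toℕ k) then ⌊ right u ≟ v ⌋ else ⌊ left u ≟ v ⌋)
  alternating-hits u v k with isEven (toℕ k)
  ... | true  = refl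
  ... | false = refl

  alternating-valid : ∀ u m → ValidRotorSeq N u m (alternating u)
  alternating-valid u m v with v ≟ right u | v ≟ left u
  ... | yes refl | _ =
    (λ _ → trans (countFin-cong (m * 2) _ _ hits-right) (countFin-even m)) ,
    (λ not-adj → ⊥-elim (not-adj (right-adjacent u)))
    where
    hits-right : ∀ k → ⌊ alternating u k ≟ right u ⌋ ≡ isEven (toℕ k)
    hits-right k rewrite alternating-hits u (right u) k
                       | ≟-yes {a = right u} refl | ≟-no (right≢left u ∘ sym) with isEven (toℕ k)
    ... | true  = refl
    ... | false = refl
  ... | no _ | yes refl =
    (λ _ → trans (countFin-cong (m * 2) _ _ hits-left) (countFin-odd m)) ,
    (λ not-adj → ⊥-elim (not-adj (left-adjacent u)))
    where
    hits-left : ∀ k → ⌊ alternating u k ≟ left u ⌋ ≡ not (isEven (toℕ k))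
    hits-left k rewrite alternating-hits u (left u) k
                      | ≟-yes {a = left u} refl | ≟-no (right≢left u) with isEven (toℕ k)
    ... | true  = refl
    ... | false = refl
  ... | no v≢right | no v≢left =
    (λ adj → ⊥-elim (not-neighbour (neighbours u v adj))) ,
    (λ _ → trans (countFin-cong (m * 2) _ _ misses) (countFin-never (m * 2)))
    where
    not-neighbour : ¬ (v ≡ right u ⊎ v ≡ left u)
    not-neighbour (inj₁ v≡right) = v≢right v≡right
    not-neighbour (inj₂ v≡left)  = v≢left v≡left
    misses : ∀ k → ⌊ alternating u k ≟ v ⌋ ≡ false
    misses k rewrite alternating-hits u v k
                   | ≟-no (v≢right ∘ sym) | ≟-no (v≢left ∘ sym) with isEven (toℕ k)
    ... | true  = refl
    ... | false = refl

-- The rotor configuration in the middle of a sweep, read off along positions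
-- j = 0, 1, …, N-1 (true = "points right").  The rotor at X itself is not constrained.
record Pattern (l X r : ℕ) (b : Bool) (j : ℕ) : Set where
  constructor mkPattern
  field
    below  : j < l → b ≡ true
    behind : l ≤ j → j < X → b ≡ false
    ahead  : X < j → j ≤ r → b ≡ true
    beyond : r < j → b ≡ false

-- Each of the four moves of a sweep changes the pattern parameters; for each we
-- record (1) that the pattern persists at positions the walker neither leaves
-- nor enters, (2) that the flipped rotor at the vacated position fits the new
-- pattern, and (3) which way the rotor at the entered position points.

advance-right-others : ∀ {l X r b j} → j ≢ X → Pattern l X r b j → Pattern l (suc X) r b j
advance-right-others j≢X (mkPattern bel beh ahe bey) =
  mkPattern bel (λ l≤j j≤X → beh l≤j (≤∧≢⇒< (≤-pred j≤X) j≢X)) (λ X<j → ahe (<⇒≤ X<j)) bey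

advance-right-vacated : ∀ {l X r} → l ≤ X → X < r → Pattern l (suc X) r false X
advance-right-vacated l≤X X<r =
  mkPattern (impossible l≤X) (λ _ _ → refl) (impossible (n≤1+n _)) (impossible (<⇒≤ X<r))

advance-right-entered : ∀ {l X r b} → X < r → Pattern l X r b (suc X) → b ≡ true
advance-right-entered X<r P = Pattern.ahead P ≤-refl X<r

extend-right-others : ∀ {l r b j} → j ≢ r → Pattern l r r b j → Pattern l (suc r) (suc r) b j
extend-right-others j≢r (mkPattern bel beh ahe bey) =
  mkPattern bel (λ l≤j j≤r → beh l≤j (≤∧≢⇒< (≤-pred j≤r) j≢r)) (λ r<j j≤r → impossible j≤r r<j)
          (λ r<j → bey (<-trans (n<1+n _) r<j))

extend-right-vacated : ∀ {l r} → l ≤ r → Pattern l (suc r) (suc r) false r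
extend-right-vacated l≤r =
  mkPattern (impossible l≤r) (λ _ _ → refl) (impossible (n≤1+n _)) (impossible (n≤1+n _))

extend-right-entered : ∀ {l r b} → Pattern l r r b (suc r) → b ≡ false
extend-right-entered P = Pattern.beyond P ≤-refl

advance-left-others : ∀ {l X r b j} → j ≢ suc X → Pattern l (suc X) r b j → Pattern l X r b j
advance-left-others j≢X+1 (mkPattern bel beh ahe bey) =
  mkPattern bel (λ l≤j j<X → beh l≤j (m<n⇒m<1+n j<X)) (λ X<j → ahe (≤∧≢⇒< X<j (j≢X+1 ∘ sym))) bey

advance-left-vacated : ∀ {l X r} → l ≤ X → suc X ≤ r → Pattern l X r true (suc X)
advance-left-vacated l≤X X<r =
  mkPattern (impossible (m≤n⇒m≤1+n l≤X)) (λ _ → impossible (n≤1+n _)) (λ _ _ → refl) (impossible X<r)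

advance-left-entered : ∀ {l X r b} → l ≤ X → Pattern l (suc X) r b X → b ≡ false
advance-left-entered l≤X P = Pattern.behind P l≤X ≤-refl

extend-left-others : ∀ {l r b j} → j ≢ suc l → Pattern (suc l) (suc l) r b j → Pattern l l r b j
extend-left-others j≢l+1 (mkPattern bel beh ahe bey) =
  mkPattern (λ j<l → bel (m<n⇒m<1+n j<l)) (λ l≤j j<l → impossible l≤j j<l)
          (λ l<j → ahe (≤∧≢⇒< l<j (j≢l+1 ∘ sym))) bey

extend-left-vacated : ∀ {l r} → suc l ≤ r → Pattern l l r true (suc l)
extend-left-vacated l<r =
  mkPattern (impossible (n≤1+n _)) (λ _ → impossible (n≤1+n _)) (λ _ _ → refl) (impossible l<r)

extend-left-entered : ∀ {l r b} → Pattern (suc l) (suc l) r b l → b ≡ true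
extend-left-entered P = Pattern.below P ≤-refl

module SlowWalk (n' : ℕ) (2≤n' : 2 ≤ n') (m : Fin (suc n') → ℕ) (1≤m : ∀ u → 1 ≤ m u) where
  open Cycle n' 2≤n'

  Rotors : Set
  Rotors = (u : Fin N) → Fin (m u * 2)

  rotorSeq : (u : Fin N) → Fin (m u * 2) → Fin N
  rotorSeq u = alternating u

  h : ℕ
  h = ⌊ N /2⌋

  start : Fin N
  start = fromℕ< (⌊n/2⌋<n n')

  2≤length : ∀ u → 2 ≤ m u * 2
  2≤length u = *-monoˡ-≤ 2 (1≤m u)

  initialRotors : Rotors
  initialRotors u with toℕ u ≤? h
  ... | yes _ = fromℕ< (≤-trans (s≤s z≤n) (2≤length u))
  ... | no  _ = fromℕ< (2≤length u)

  facesRight : Rotors → Fin N → Bool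
  facesRight ρ v = isEven (toℕ (ρ v))

  initially-right : ∀ v → toℕ v ≤ h → facesRight initialRotors v ≡ true
  initially-right v v≤h with toℕ v ≤? h
  ... | yes _   = cong isEven (toℕ-fromℕ< (≤-trans (s≤s z≤n) (2≤length v)))
  ... | no  v≰h = ⊥-elim (v≰h v≤h)

  initially-left : ∀ v → h < toℕ v → facesRight initialRotors v ≡ false
  initially-left v h<v with toℕ v ≤? h
  ... | yes v≤h = impossible v≤h h<v
  ... | no  _   = cong isEven (toℕ-fromℕ< (2≤length v))

  pos : ℕ → Fin N
  pos s = proj₁ (walk rotorSeq (start , initialRotors) s)

  rotors : ℕ → Rotors
  rotors s = proj₂ (walk rotorSeq (start , initialRotors) s)

  moves : ∀ s → pos (suc s) ≡ (if facesRight (rotors s) (pos s) then right (pos s) else left (pos s))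
  moves s = refl

  flips-here : ∀ s → facesRight (rotors (suc s)) (pos s) ≡ not (facesRight (rotors s) (pos s))
  flips-here s = trans (cong (isEven ∘ toℕ) (advance-here (rotors s) (pos s)))
                       (nextFin-flips-parity (m (pos s) * 2) (rotors s (pos s)) (isEven-double (m (pos s))))

  keeps-elsewhere : ∀ s v → v ≢ pos s → facesRight (rotors (suc s)) v ≡ facesRight (rotors s) v
  keeps-elsewhere s v v≢pos = cong (isEven ∘ toℕ) (advance-elsewhere (rotors s) (pos s) v v≢pos)

  -- The walk at time s is in the middle of a sweep: it has swept the interval
  -- [l, r] ∋ h back and forth in passes of lengths 1, 2, …, and is now at
  -- X = l + gapL = r - gapR moving in direction d (true = right), with
  -- progress gapL (moving right) or gapR (moving left) in the current pass.
  record Sweep (s : ℕ) : Set where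
    field
      l X r gapL gapR : ℕ
      d       : Bool
      X≡      : X ≡ l + gapL
      r≡      : r ≡ X + gapR
      r<N     : r < N
      l≤h     : l ≤ h
      h≤r     : h ≤ r
      at      : toℕ (pos s) ≡ X
      facing  : facesRight (rotors s) (pos s) ≡ d
      shape   : ∀ v → toℕ v ≢ X → Pattern l X r (facesRight (rotors s) v) (toℕ v)
      clock   : s ≡ tri (gapL + gapR) + (if d then gapL else gapR)
      visited : ∀ s' → s' ≤ s → l ≤ toℕ (pos s') × toℕ (pos s') ≤ r

  initial-sweep : Sweep 0
  initial-sweep = record
    { l = h ; X = h ; r = h ; gapL = 0 ; gapR = 0 ; d = true
    ; X≡ = sym (+-identityʳ h) ; r≡ = sym (+-identityʳ h) ; r<N = ⌊n/2⌋<n n'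
    ; l≤h = ≤-refl ; h≤r = ≤-refl ; at = at-start
    ; facing = initially-right start (≤-reflexive at-start)
    ; shape = λ v _ → mkPattern (λ v<h → initially-right v (<⇒≤ v<h)) impossible
                                  (λ h<v v≤h → impossible v≤h h<v) (initially-left v)
    ; clock = refl
    ; visited = λ { .zero z≤n → ≤-reflexive (sym at-start) , ≤-reflexive at-start } }
    where
    at-start : toℕ start ≡ h
    at-start = toℕ-fromℕ< (⌊n/2⌋<n n')

  module Move {s : ℕ} (S : Sweep s) where
    open Sweep S

    l≤X : l ≤ X
    l≤X = subst (l ≤_) (sym X≡) (m≤m+n l gapL)

    X≤r : X ≤ r
    X≤r = subst (X ≤_) (sym r≡) (m≤m+n X gapR)

    -- The rotor pattern of the next state, given the move's facts (1) and (2);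
    -- the old direction and parameters may be presented as b = d, L = l, Y = X.
    shape-after : ∀ {b L Y l' X' r'} → d ≡ b → l ≡ L → X ≡ Y → Pattern l' X' r' (not b) Y →
                  (∀ {c j} → j ≢ Y → Pattern L Y r c j → Pattern l' X' r' c j) →
                  ∀ v → toℕ v ≢ X' → Pattern l' X' r' (facesRight (rotors (suc s)) v) (toℕ v)
    shape-after {l' = l'} {X'} {r'} refl refl refl vacated others v _ = by-cases (v ≟ pos s)
      where
      -- (deciding v ≡ pos s without `with`, which would also rewrite `advance`)
      by-cases : Dec (v ≡ pos s) → Pattern l' X' r' (facesRight (rotors (suc s)) v) (toℕ v)
      by-cases (yes v≡pos) =
        subst₂ (Pattern l' X' r') flipped (trans (sym at) (cong toℕ (sym v≡pos))) vacated
        where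
        flipped : not d ≡ facesRight (rotors (suc s)) v
        flipped = begin
          not d                                  ≡⟨ cong not (sym facing) ⟩
          not (facesRight (rotors s) (pos s))    ≡⟨ sym (flips-here s) ⟩
          facesRight (rotors (suc s)) (pos s)    ≡⟨ cong (facesRight (rotors (suc s))) (sym v≡pos) ⟩
          facesRight (rotors (suc s)) v          ∎
          where open ≡-Reasoning
      by-cases (no v≢pos) =
        subst (λ c → Pattern l' X' r' c (toℕ v)) (sym (keeps-elsewhere s v v≢pos))
              (others v≢X (shape v v≢X))
        where
        v≢X : toℕ v ≢ X
        v≢X v≡X = v≢pos (toℕ-injective (trans v≡X (sym at)))

    entered : ∀ {L Y j} → l ≡ L → X ≡ Y → toℕ (pos (suc s)) ≡ j → j ≢ Y →
              Pattern L Y r (facesRight (rotors (suc s)) (pos (suc s))) j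
    entered refl refl refl j≢X =
      subst (λ b → Pattern l X r b (toℕ (pos (suc s))))
            (sym (keeps-elsewhere s (pos (suc s)) (λ new≡pos → j≢X (trans (cong toℕ new≡pos) at))))
            (shape (pos (suc s)) j≢X)

    visited-after : ∀ {l' r' j} → l' ≤ l → r ≤ r' → toℕ (pos (suc s)) ≡ j → l' ≤ j → j ≤ r' →
                    ∀ s' → s' ≤ suc s → l' ≤ toℕ (pos s') × toℕ (pos s') ≤ r'
    visited-after l'≤l r≤r' refl l'≤new new≤r' s' s'≤s+1 with m≤n⇒m<n∨m≡n s'≤s+1
    ... | inj₂ refl  = l'≤new , new≤r'
    ... | inj₁ s'≤s with visited s' (≤-pred s'≤s)
    ...   | l≤old , old≤r = ≤-trans l'≤l l≤old , ≤-trans old≤r r≤r'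

    moved : ∀ {b} → d ≡ b → pos (suc s) ≡ (if b then right (pos s) else left (pos s))
    moved d≡b = trans (moves s) (cong (λ c → if c then right (pos s) else left (pos s)) (trans facing d≡b))

    progress : ∀ {b} → d ≡ b → s ≡ tri (gapL + gapR) + (if b then gapL else gapR)
    progress refl = clock

    right-end : gapR ≡ 0 → X ≡ r
    right-end gapR≡ = sym (trans r≡ (trans (cong (X +_) gapR≡) (+-identityʳ X)))

    left-end : gapL ≡ 0 → X ≡ l
    left-end gapL≡ = trans X≡ (trans (cong (l +_) gapL≡) (+-identityʳ l))

    right-pass-done : d ≡ true → gapR ≡ 0 → suc s ≡ tri (suc gapL)
    right-pass-done d≡true gapR≡ = turn gapL (trans (progress d≡true) (cong (λ w → tri w + gapL) width))
      where
      width : gapL + gapR ≡ gapL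
      width = trans (cong (gapL +_) gapR≡) (+-identityʳ gapL)

    left-pass-done : d ≡ false → gapL ≡ 0 → suc s ≡ tri (suc gapR)
    left-pass-done d≡false gapL≡ =
      turn gapR (trans (progress d≡false) (cong (λ w → tri (w + gapR) + gapR) gapL≡))

    advance-right : d ≡ true → ∀ c → gapR ≡ suc c → Sweep (suc s)
    advance-right d≡true c gapR≡ = record
      { l = l ; X = suc X ; r = r ; gapL = suc gapL ; gapR = c ; d = true
      ; X≡ = trans (cong suc X≡) (sym (+-suc l gapL))
      ; r≡ = trans r≡ (trans (cong (X +_) gapR≡) (+-suc X c))
      ; r<N = r<N ; l≤h = l≤h ; h≤r = h≤r ; at = at'
      ; facing = advance-right-entered X<r (entered refl refl at' (1+n≢n))
      ; shape = shape-after d≡true refl refl (advance-right-vacated l≤X X<r) advance-right-others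
      ; clock = subst (λ w → suc s ≡ tri w + suc gapL) width (tick (gapL + gapR) (progress d≡true))
      ; visited = visited-after ≤-refl ≤-refl at' (m≤n⇒m≤1+n l≤X) X<r }
      where
      X<r : X < r
      X<r = subst (X <_) (sym (trans r≡ (cong (X +_) gapR≡))) (m<m+n X z<s)
      at' : toℕ (pos (suc s)) ≡ suc X
      at' = begin
        toℕ (pos (suc s))     ≡⟨ cong toℕ (moved d≡true) ⟩
        toℕ (right (pos s))   ≡⟨ right-step (pos s) (subst (λ x → suc x < N) (sym at) (≤-trans (s≤s X<r) r<N)) ⟩
        suc (toℕ (pos s))     ≡⟨ cong suc at ⟩
        suc X                 ∎
        where open ≡-Reasoning
      width : gapL + gapR ≡ suc gapL + c
      width = trans (cong (gapL +_) gapR≡) (+-suc gapL c)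

    extend-right : d ≡ true → gapR ≡ 0 → suc r < N → Sweep (suc s)
    extend-right d≡true gapR≡ r+1<N = record
      { l = l ; X = suc r ; r = suc r ; gapL = suc gapL ; gapR = 0 ; d = false
      ; X≡ = trans (cong suc (trans (sym X≡r) X≡)) (sym (+-suc l gapL))
      ; r≡ = sym (+-identityʳ (suc r))
      ; r<N = r+1<N ; l≤h = l≤h ; h≤r = m≤n⇒m≤1+n h≤r ; at = at'
      ; facing = extend-right-entered (entered refl X≡r at' 1+n≢n)
      ; shape = shape-after d≡true refl X≡r (extend-right-vacated l≤r) extend-right-others
      ; clock = trans (right-pass-done d≡true gapR≡)
                      (sym (trans (+-identityʳ _) (cong tri (+-identityʳ (suc gapL)))))
      ; visited = visited-after ≤-refl (n≤1+n r) at' (m≤n⇒m≤1+n l≤r) ≤-refl }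
      where
      l≤r : l ≤ r
      l≤r = ≤-trans l≤X X≤r
      X≡r : X ≡ r
      X≡r = right-end gapR≡
      at' : toℕ (pos (suc s)) ≡ suc r
      at' = begin
        toℕ (pos (suc s))     ≡⟨ cong toℕ (moved d≡true) ⟩
        toℕ (right (pos s))   ≡⟨ right-step (pos s) (subst (λ x → suc x < N) (sym (trans at X≡r)) r+1<N) ⟩
        suc (toℕ (pos s))     ≡⟨ cong suc (trans at X≡r) ⟩
        suc r                 ∎
        where open ≡-Reasoning

    advance-left : d ≡ false → ∀ a → gapL ≡ suc a → Sweep (suc s)
    advance-left d≡false a gapL≡ = record
      { l = l ; X = l + a ; r = r ; gapL = a ; gapR = suc gapR ; d = false
      ; X≡ = refl
      ; r≡ = trans r≡ (trans (cong (_+ gapR) X≡Y+1) (sym (+-suc (l + a) gapR)))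
      ; r<N = r<N ; l≤h = l≤h ; h≤r = h≤r ; at = at'
      ; facing = advance-left-entered l≤Y (entered refl X≡Y+1 at' (<⇒≢ (n<1+n _)))
      ; shape = shape-after d≡false refl X≡Y+1 (advance-left-vacated l≤Y Y<r) advance-left-others
      ; clock = subst (λ w → suc s ≡ tri w + suc gapR) width (tick (gapL + gapR) (progress d≡false))
      ; visited = visited-after ≤-refl ≤-refl at' l≤Y (<⇒≤ Y<r) }
      where
      X≡Y+1 : X ≡ suc (l + a)
      X≡Y+1 = trans X≡ (trans (cong (l +_) gapL≡) (+-suc l a))
      l≤Y : l ≤ l + a
      l≤Y = m≤m+n l a
      Y<r : l + a < r
      Y<r = subst (_≤ r) X≡Y+1 X≤r
      at' : toℕ (pos (suc s)) ≡ l + a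
      at' = trans (cong toℕ (moved d≡false)) (left-step (pos s) (l + a) (trans at X≡Y+1))
      width : gapL + gapR ≡ a + suc gapR
      width = trans (cong (_+ gapR) gapL≡) (sym (+-suc a gapR))

    extend-left : d ≡ false → gapL ≡ 0 → ∀ l' → l ≡ suc l' → Sweep (suc s)
    extend-left d≡false gapL≡ l' l≡ = record
      { l = l' ; X = l' ; r = r ; gapL = 0 ; gapR = suc gapR ; d = true
      ; X≡ = sym (+-identityʳ l')
      ; r≡ = trans r≡ (trans (cong (_+ gapR) X≡l'+1) (sym (+-suc l' gapR)))
      ; r<N = r<N ; l≤h = ≤-trans (n≤1+n l') (subst (_≤ h) l≡ l≤h) ; h≤r = h≤r ; at = at'
      ; facing = extend-left-entered (entered l≡ X≡l'+1 at' (<⇒≢ (n<1+n _)))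
      ; shape = shape-after d≡false l≡ X≡l'+1 (extend-left-vacated l'<r) extend-left-others
      ; clock = trans (left-pass-done d≡false gapL≡) (sym (+-identityʳ _))
      ; visited = visited-after (subst (l' ≤_) (sym l≡) (n≤1+n l')) ≤-refl at' ≤-refl (<⇒≤ l'<r) }
      where
      X≡l'+1 : X ≡ suc l'
      X≡l'+1 = trans (left-end gapL≡) l≡
      l'<r : l' < r
      l'<r = subst (_≤ r) X≡l'+1 X≤r
      at' : toℕ (pos (suc s)) ≡ l'
      at' = trans (cong toℕ (moved d≡false)) (left-step (pos s) l' (trans at X≡l'+1))

    runs-off-right : d ≡ true → gapR ≡ 0 → ¬ (suc r < N) → N * N ≤ 8 * suc s
    runs-off-right d≡true gapR≡ r+1≮N = begin
      N * N                ≤⟨ quadratic N (suc gapL) (wrap-right-width N l gapL h N≡ l≤h (half-lower N)) ⟩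
      8 * tri (suc gapL)   ≡⟨ cong (8 *_) (sym (right-pass-done d≡true gapR≡)) ⟩
      8 * suc s            ∎
      where
      open ≤-Reasoning
      N≡ : N ≡ suc (l + gapL)
      N≡ = trans (≤-antisym (≮⇒≥ r+1≮N) r<N) (cong suc (trans (sym (right-end gapR≡)) X≡))

    runs-off-left : d ≡ false → gapL ≡ 0 → l ≡ 0 → N * N ≤ 8 * suc s
    runs-off-left d≡false gapL≡ l≡0 = begin
      N * N                ≤⟨ quadratic N (suc gapR) (wrap-left-width N gapR h h≤gapR (half-upper N)) ⟩
      8 * tri (suc gapR)   ≡⟨ cong (8 *_) (sym (left-pass-done d≡false gapL≡)) ⟩
      8 * suc s            ∎
      where
      open ≤-Reasoning
      h≤gapR : h ≤ gapR
      h≤gapR = subst (h ≤_) (trans r≡ (cong (_+ gapR) (trans (left-end gapL≡) l≡0))) h≤r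

    next : 8 * suc s < N * N → Sweep (suc s)
    next fast with d in d≡ | gapR in gapR≡ | gapL in gapL≡
    ... | true  | suc c | _     = advance-right d≡ c gapR≡
    ... | true  | zero  | _     with suc r <? N
    ...   | yes r+1<N = extend-right d≡ gapR≡ r+1<N
    ...   | no  r+1≮N = impossible (runs-off-right d≡ gapR≡ r+1≮N) fast
    next fast | false | _ | suc a = advance-left d≡ a gapL≡
    next fast | false | _ | zero  with l in l≡
    ...   | suc l' = extend-left d≡ gapL≡ l' l≡
    ...   | zero   = impossible (runs-off-left d≡ gapL≡ l≡) fast

  sweeping : ∀ s → 8 * s < N * N → Sweep s
  sweeping zero    _    = initial-sweep
  sweeping (suc s) fast = Move.next (sweeping s (≤-<-trans (*-monoʳ-≤ 8 (n≤1+n s)) fast)) fast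

  -- Covering the cycle within a sweep forces the interval to be all of
  -- [0, N-1], i.e. a full pass of width N - 1 ≥ N/2 has been completed.
  covering-is-slow : ∀ t → Sweep t → CoveredBy rotorSeq (start , initialRotors) t → N * N ≤ 8 * t
  covering-is-slow t S covered = begin
    N * N                   ≤⟨ quadratic N (gapL + gapR) N≤2w ⟩
    8 * tri (gapL + gapR)   ≤⟨ *-monoʳ-≤ 8 (m≤m+n (tri (gapL + gapR)) _) ⟩
    8 * (tri (gapL + gapR) + (if d then gapL else gapR)) ≡⟨ cong (8 *_) (sym clock) ⟩
    8 * t                   ∎
    where
    open Sweep S
    open ≤-Reasoning
    l≡0 : l ≡ 0
    l≡0 with covered F.zero
    ... | s' , s'≤t , at0 = n≤0⇒n≡0 (subst (l ≤_) (cong toℕ at0) (proj₁ (visited s' s'≤t)))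
    n'≤r : n' ≤ r
    n'≤r with covered (fromℕ n')
    ... | s' , s'≤t , atn' = subst (_≤ r) (trans (cong toℕ atn') (toℕ-fromℕ n')) (proj₂ (visited s' s'≤t))
    r≡w : r ≡ gapL + gapR
    r≡w = trans r≡ (cong (_+ gapR) (trans X≡ (cong (_+ gapL) l≡0)))
    N≤2w : N ≤ 2 * (gapL + gapR)
    N≤2w = begin
      suc n'                        ≤⟨ +-monoˡ-≤ n' (≤-trans (s≤s z≤n) 2≤n') ⟩
      n' + n'                       ≤⟨ +-mono-≤ n'≤r n'≤r ⟩
      r + r                         ≡⟨ cong₂ _+_ r≡w (trans r≡w (sym (+-identityʳ _))) ⟩
      2 * (gapL + gapR)             ∎

  slow : ∀ t → 8 * t < N * N → ¬ CoveredBy rotorSeq (start , initialRotors) t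
  slow t fast covered = impossible (covering-is-slow t (sweeping t fast) covered) fast

cycle-cover-time : ∀ (n : ℕ) → 3 ≤ n → ∀ (m : Fin n → ℕ) → (∀ u → 1 ≤ m u) →
  ∃ λ (x₀ : Fin n) →
  ∃ λ (seq : (u : Fin n) → Fin (m u * 2) → Fin n) →
  (∀ u → ValidRotorSeq n u (m u) (seq u)) ×
  ∃ λ (ρ₀ : (u : Fin n) → Fin (m u * 2)) →
  ∀ (t : ℕ) → 8 * t < n * n → ¬ CoveredBy seq (x₀ , ρ₀) t
cycle-cover-time (suc n') (s≤s 2≤n') m 1≤m =
  start , rotorSeq , (λ u → alternating-valid u (m u)) , initialRotors , slow
  where
  open Cycle n' 2≤n'
  open SlowWalk n' 2≤n' m 1≤m

theorem4p3 : ∃ λ (p : ℕ) → ∃ λ (q : ℕ) → 1 ≤ p × 1 ≤ q ×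
    (∀ (n : ℕ) → 3 ≤ n → ∀ (m : Fin n → ℕ) → (∀ u → 1 ≤ m u) →
      ∃ λ (x₀ : Fin n) →
      ∃ λ (seq : (u : Fin n) → Fin (m u * 2) → Fin n) →
      (∀ u → ValidRotorSeq n u (m u) (seq u)) ×
      ∃ λ (ρ₀ : (u : Fin n) → Fin (m u * 2)) →
      ∀ (t : ℕ) → q * t < p * (n * n) → ¬ CoveredBy seq (x₀ , ρ₀) t)
theorem4p3 = 1 , 8 , ≤-refl , s≤s z≤n , λ n 3≤n m 1≤m →
  let x₀ , seq , valid , ρ₀ , slow = cycle-cover-time n 3≤n m 1≤m
  in  x₀ , seq , valid , ρ₀ , λ t fast → slow t (subst (8 * t <_) (*-identityˡ (n * n)) fast)
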